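{- Let $X$ be a mixed graph whose underlying graph $\Gamma(X)$ is bipartite and has a unique perfect matching, let $\alpha$ be a complex number with $|\alpha|=1$, and let $H_\alpha$ be the $\alpha$-hermitian adjacency matrix of $X$. Then $H_\alpha$ is nonsingular.
   Context: A mixed graph $X$ consists of a finite vertex set $V(X)$, a set $E_0(X)$ of undirected edges (digons) and a set $E_1(X)$ of directed edges (arcs), with no loops and at most one digon or arc between any two distinct vertices. Its underlying graph $\Gamma(X)$ is obtained by forgetting the orientations of the arcs; a perfect matching of $X$ means a perfect matching of $\Gamma(X)$. For a complex number $\alpha$ of modulus $1$, the $\alpha$-hermitian adjacency matrix $H_\alpha(X)=[h_{uv}]_{u,v\in V(X)}$ is defined by $h_{uv}=1$ if $uv\in E_0(X)$, $h_{uv}=\alpha$ if $uv\in E_1(X)$ (arc from $u$ to $v$), $h_{uv}=\overline{\alpha}$ if $vu\in E_1(X)$, and $h_{uv}=0$ otherwise. -}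

module Defs where

open import Level using (Level; _⊔_)
open import Data.Nat using (ℕ; zero; suc)
open import Data.Fin using (Fin; zero; suc)
open import Data.Bool using (Bool)
open import Data.Product using (Σ; _×_; ∃; _,_)
open import Relation.Binary.PropositionalEquality using (_≡_; _≢_)
open import Relation.Nullary using (¬_)
open import Algebra.Bundles using (CommutativeRing)

-- For an ordered pair (u , v) the relation between u and v is one of:
--   none     : no digon and no arc between u and v
--   digon    : an undirected edge uv ∈ E₀
--   arcTo    : an arc from u to v  (uv ∈ E₁)
--   arcFrom  : an arc from v to u  (vu ∈ E₁)
-- At most one digon or arc between two vertices is built in.

data Link : Set where
  none digon arcTo arcFrom : Link

reverse : Link → Link
reverse none    = none
reverse digon   = digon
reverse arcTo   = arcFrom
reverse arcFrom = arcTo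

record MixedGraph (n : ℕ) : Set where
  field
    link      : Fin n → Fin n → Link
    loopless  : ∀ u → link u u ≡ none
    consistent : ∀ u v → link v u ≡ reverse (link u v)

open MixedGraph public

Adj : ∀ {n} → MixedGraph n → Fin n → Fin n → Set
Adj X u v = link X u v ≢ none

Bipartite : ∀ {n} → MixedGraph n → Set
Bipartite {n} X = Σ (Fin n → Bool) λ c → ∀ u v → Adj X u v → c u ≢ c v

-- A perfect matching of Γ(X), given as the map sending each vertex to
-- its partner: a fixed-point-free involution along edges of Γ(X).
IsPerfectMatching : ∀ {n} → MixedGraph n → (Fin n → Fin n) → Set
IsPerfectMatching X m =
  (∀ u → Adj X u (m u)) × (∀ u → m (m u) ≡ u)

UniquePerfectMatching : ∀ {n} → MixedGraph n → Set
UniquePerfectMatching {n} X =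
  Σ (Fin n → Fin n) λ m → IsPerfectMatching X m ×
    (∀ m′ → IsPerfectMatching X m′ → ∀ u → m′ u ≡ m u)

-- A commutative ring with an involution ("conjugation"), abstracting ℂ.

record InvolutiveCommRing c ℓ : Set (Level.suc (c ⊔ ℓ)) where
  field
    commRing : CommutativeRing c ℓ
  open CommutativeRing commRing public
  field
    conj      : Carrier → Carrier
    conj-cong : ∀ {x y} → x ≈ y → conj x ≈ conj y
    conj-invol : ∀ x → conj (conj x) ≈ x
    conj-+    : ∀ x y → conj (x + y) ≈ conj x + conj y
    conj-*    : ∀ x y → conj (x * y) ≈ conj x * conj y
    conj-1    : conj 1# ≈ 1#

module _ {c ℓ} (K : InvolutiveCommRing c ℓ) where
  open InvolutiveCommRing K using (Carrier; _≈_; _+_; _*_; 0#; 1#; conj)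

  Matrix : ℕ → Set c
  Matrix n = Fin n → Fin n → Carrier

  sumFin : ∀ n → (Fin n → Carrier) → Carrier
  sumFin zero    f = 0#
  sumFin (suc n) f = f zero + sumFin n (λ i → f (suc i))

  _·_ : ∀ {n} → Matrix n → Matrix n → Matrix n
  _·_ {n} A B i j = sumFin n (λ k → A i k * B k j)

  identity : ∀ {n} → Matrix n
  identity zero    zero    = 1#
  identity zero    (suc j) = 0#
  identity (suc i) zero    = 0#
  identity (suc i) (suc j) = identity i j

  Nonsingular : ∀ {n} → Matrix n → Set (c ⊔ ℓ)
  Nonsingular {n} A = Σ (Matrix n) λ B →
    (∀ i j → (A · B) i j ≈ identity i j) × (∀ i j → (B · A) i j ≈ identity i j)

  hermitianAdj : ∀ {n} → Carrier → MixedGraph n → Matrix n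
  hermitianAdj α X u v with link X u v
  ... | none    = 0#
  ... | digon   = 1#
  ... | arcTo   = α
  ... | arcFrom = conj α

-- Let M keep the entries of H on the edges of the unique perfect matching m. As
-- h(u,v) h(v,u) = 1 on every edge (α ᾱ = 1), M is an involution, so H = M (1 - B) with
-- B = M (M - H), and B(u,w) vanishes unless w ≠ u is a neighbour of m(u). A nonzero
-- entry of Bⁿ would give such an alternating walk of length n, which must close up; following
-- it yields a permutation π sending every vertex x to a neighbour of m(x) and moving some
-- vertex. Re-matching one colour class of the bipartition backwards along π and the other
-- forwards gives a second perfect matching. Hence B is nilpotent and H has the inverse
-- (Σₖ Bᵏ) M.

module Submission where

open import Level using (_⊔_)
open import Algebra.Bundles using (Ring; Semiring)
import Algebra.Construct.Pointwise as Pointwise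
open import Data.Bool using (Bool; true; false; not; if_then_else_)
open import Data.Bool.Properties using (¬-not; not-injective)
open import Data.Empty using (⊥-elim)
open import Data.Fin using (Fin; zero; suc; toℕ; fromℕ<; punchIn; _≟_)
open import Data.Fin.Permutation using (Permutation′; permutation; _⟨$⟩ʳ_; _⟨$⟩ˡ_; inverseˡ; inverseʳ)
open import Data.Fin.Properties using (pigeonhole; any?; toℕ<n; toℕ≤pred[n]; toℕ-fromℕ<; punchInᵢ≢i)
open import Data.Nat using (ℕ; zero; suc; _<_; s<s)
open import Data.Product using (∃; ∃₂; _×_; _,_; proj₁; proj₂)
open import Data.Sum using (_⊎_; inj₁; inj₂; map₂)
open import Function using (_∘_)
open import Relation.Binary using (Rel; Decidable)
open import Relation.Binary.PropositionalEquality as ≡ using (_≡_; _≢_)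
open import Relation.Nullary using (¬_; Dec; yes; no; ¬?; _×-dec_)

open import Defs

module RingInverses {c ℓ} (R : Ring c ℓ) where
  open Ring R
  open import Algebra.Properties.Ring R
    using (x[y-z]≈xy-xz; [y-z]x≈yx-zx; \\-leftDividesʳ; //-rightDividesˡ; ⁻¹-anti-homo-//; -0#≈0#)
  open import Algebra.Definitions.RawSemiring (Semiring.rawSemiring semiring) using (_^_)
  open import Relation.Binary.Reasoning.Setoid setoid

  Invertible : Carrier → Set (c ⊔ ℓ)
  Invertible x = ∃ λ y → x * y ≈ 1# × y * x ≈ 1#

  invertible-cong : ∀ {x y} → x ≈ y → Invertible x → Invertible y
  invertible-cong x≈y (z , xz≈1 , zx≈1) =
    z , trans (*-congʳ (sym x≈y)) xz≈1 , trans (*-congˡ (sym x≈y)) zx≈1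

  invertible-* : ∀ {x y} → Invertible x → Invertible y → Invertible (x * y)
  invertible-* {x} {y} (x′ , xx′≈1 , x′x≈1) (y′ , yy′≈1 , y′y≈1) =
    y′ * x′ , cancel x y x′ y′ yy′≈1 xx′≈1 , cancel y′ x′ y x x′x≈1 y′y≈1
    where
    cancel : ∀ a b a′ b′ → b * b′ ≈ 1# → a * a′ ≈ 1# → (a * b) * (b′ * a′) ≈ 1#
    cancel a b a′ b′ bb′≈1 aa′≈1 = begin
      (a * b) * (b′ * a′) ≈⟨ *-assoc a b (b′ * a′) ⟩
      a * (b * (b′ * a′)) ≈⟨ *-congˡ (*-assoc b b′ a′) ⟨
      a * ((b * b′) * a′) ≈⟨ *-congˡ (*-congʳ bb′≈1) ⟩
      a * (1# * a′)       ≈⟨ *-congˡ (*-identityˡ a′) ⟩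
      a * a′              ≈⟨ aa′≈1 ⟩
      1#                  ∎

  geometricSum : Carrier → ℕ → Carrier
  geometricSum x zero    = 0#
  geometricSum x (suc k) = 1# + x * geometricSum x k

  private
    telescope : ∀ x y → (1# - x) + x * (1# - y) ≈ 1# - x * y
    telescope x y = begin
      (1# - x) + x * (1# - y)  ≈⟨ +-congˡ (trans (x[y-z]≈xy-xz x 1# y) (+-congʳ (*-identityʳ x))) ⟩
      (1# - x) + (x - x * y)   ≈⟨ +-assoc 1# (- x) (x - x * y) ⟩
      1# + (- x + (x - x * y)) ≈⟨ +-congˡ (\\-leftDividesʳ x (- (x * y))) ⟩
      1# - x * y               ∎

    1-x-comm : ∀ x → (1# - x) * x ≈ x * (1# - x)
    1-x-comm x = begin
      (1# - x) * x   ≈⟨ [y-z]x≈yx-zx x 1# x ⟩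
      1# * x - x * x ≈⟨ +-congʳ (trans (*-identityˡ x) (sym (*-identityʳ x))) ⟩
      x * 1# - x * x ≈⟨ x[y-z]≈xy-xz x 1# x ⟨
      x * (1# - x)   ∎

    0≈1-1 : 0# ≈ 1# - 1#
    0≈1-1 = sym (-‿inverseʳ 1#)

  1-x*geometricSum : ∀ x k → (1# - x) * geometricSum x k ≈ 1# - x ^ k
  1-x*geometricSum x zero    = trans (zeroʳ (1# - x)) 0≈1-1
  1-x*geometricSum x (suc k) = begin
    (1# - x) * (1# + x * g)            ≈⟨ distribˡ (1# - x) 1# (x * g) ⟩
    (1# - x) * 1# + (1# - x) * (x * g) ≈⟨ +-cong (*-identityʳ (1# - x)) (sym (*-assoc (1# - x) x g)) ⟩
    (1# - x) + ((1# - x) * x) * g      ≈⟨ +-congˡ (*-congʳ (1-x-comm x)) ⟩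
    (1# - x) + (x * (1# - x)) * g      ≈⟨ +-congˡ (*-assoc x (1# - x) g) ⟩
    (1# - x) + x * ((1# - x) * g)      ≈⟨ +-congˡ (*-congˡ (1-x*geometricSum x k)) ⟩
    (1# - x) + x * (1# - x ^ k)        ≈⟨ telescope x (x ^ k) ⟩
    1# - x ^ suc k                     ∎
    where g = geometricSum x k

  geometricSum*1-x : ∀ x k → geometricSum x k * (1# - x) ≈ 1# - x ^ k
  geometricSum*1-x x zero    = trans (zeroˡ (1# - x)) 0≈1-1
  geometricSum*1-x x (suc k) = begin
    (1# + x * g) * (1# - x)            ≈⟨ distribʳ (1# - x) 1# (x * g) ⟩
    1# * (1# - x) + (x * g) * (1# - x) ≈⟨ +-cong (*-identityˡ (1# - x)) (*-assoc x g (1# - x)) ⟩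
    (1# - x) + x * (g * (1# - x))      ≈⟨ +-congˡ (*-congˡ (geometricSum*1-x x k)) ⟩
    (1# - x) + x * (1# - x ^ k)        ≈⟨ telescope x (x ^ k) ⟩
    1# - x ^ suc k                     ∎
    where g = geometricSum x k

  nilpotent⇒1-x-invertible : ∀ {x} k → x ^ k ≈ 0# → Invertible (1# - x)
  nilpotent⇒1-x-invertible {x} k xᵏ≈0 =
    geometricSum x k , trans (1-x*geometricSum x k) 1-xᵏ≈1 , trans (geometricSum*1-x x k) 1-xᵏ≈1
    where
    1-xᵏ≈1 : 1# - x ^ k ≈ 1#
    1-xᵏ≈1 = trans (+-congˡ (trans (-‿cong xᵏ≈0) -0#≈0#)) (+-identityʳ 1#)

  involution-factorisation : ∀ {m} h → m * m ≈ 1# → h ≈ m * (1# - m * (m - h))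
  involution-factorisation {m} h m²≈1 = sym (begin
    m * (1# - m * (m - h))       ≈⟨ x[y-z]≈xy-xz m 1# (m * (m - h)) ⟩
    m * 1# - m * (m * (m - h))   ≈⟨ +-cong (*-identityʳ m) (-‿cong (sym (*-assoc m m (m - h)))) ⟩
    m - (m * m) * (m - h)        ≈⟨ +-congˡ (-‿cong (trans (*-congʳ m²≈1) (*-identityˡ (m - h)))) ⟩
    m - (m - h)                  ≈⟨ +-congˡ (⁻¹-anti-homo-// m h) ⟩
    m + (h - m)                  ≈⟨ +-comm m (h - m) ⟩
    (h - m) + m                  ≈⟨ //-rightDividesˡ m h ⟩
    h                            ∎)

  near-involution-invertible : ∀ {m h} k → m * m ≈ 1# → (m * (m - h)) ^ k ≈ 0# → Invertible h
  near-involution-invertible {m} {h} k m²≈1 nilpotent =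
    invertible-cong (sym (involution-factorisation h m²≈1))
      (invertible-* (m , m²≈1 , m²≈1) (nilpotent⇒1-x-invertible k nilpotent))

IsWalk : ∀ {a r} {A : Set a} → Rel A r → ℕ → (ℕ → A) → Set r
IsWalk R k p = ∀ t → t < k → R (p t) (p (suc t))

module SquareMatrices {c ℓ} (R : Ring c ℓ) (n : ℕ) where
  open Ring R
  open import Algebra.Properties.Semiring.Sum semiring
    using (sum; sum-syntax; sum-cong-≋; sum-remove; sum-replicate-zero; ∑-distrib-+; ∑-comm;
           *-distribˡ-sum; *-distribʳ-sum)
  open import Relation.Binary.Reasoning.Setoid setoid

  Mat : Set c
  Mat = Fin n → Fin n → Carrier

  infixl 7 _*ᴹ_
  _*ᴹ_ : Mat → Mat → Mat
  (A *ᴹ B) i j = ∑[ k < n ] (A i k * B k j)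

  infix 4 _≈ᴹ_
  _≈ᴹ_ : Mat → Mat → Set ℓ
  A ≈ᴹ B = ∀ i j → A i j ≈ B i j

  δ : ∀ {m} → Fin m → Fin m → Carrier
  δ zero    zero    = 1#
  δ zero    (suc j) = 0#
  δ (suc i) zero    = 0#
  δ (suc i) (suc j) = δ i j

  δ-diag : ∀ {m} (i : Fin m) → δ i i ≡ 1#
  δ-diag zero    = ≡.refl
  δ-diag (suc i) = δ-diag i

  δ-off : ∀ {m} {i j : Fin m} → i ≢ j → δ i j ≡ 0#
  δ-off {i = zero}  {zero}  i≢j = ⊥-elim (i≢j ≡.refl)
  δ-off {i = zero}  {suc j} i≢j = ≡.refl
  δ-off {i = suc i} {zero}  i≢j = ≡.refl
  δ-off {i = suc i} {suc j} i≢j = δ-off (i≢j ∘ ≡.cong suc)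

  sum-zero : ∀ {m} {f : Fin m → Carrier} → (∀ k → f k ≈ 0#) → sum f ≈ 0#
  sum-zero {m} f≈0 = trans (sum-cong-≋ f≈0) (sum-replicate-zero m)

  sum-supported-at : ∀ {m} (f : Fin m → Carrier) i → (∀ k → k ≢ i → f k ≈ 0#) → sum f ≈ f i
  sum-supported-at {suc _} f i f≈0 = begin
    sum f                             ≈⟨ sum-remove f ⟩
    f i + sum (λ k → f (punchIn i k)) ≈⟨ +-congˡ (sum-zero (λ k → f≈0 (punchIn i k) (punchInᵢ≢i i k))) ⟩
    f i + 0#                          ≈⟨ +-identityʳ (f i) ⟩
    f i                               ∎

  *ᴹ-cong : ∀ {A A′ B B′} → A ≈ᴹ A′ → B ≈ᴹ B′ → A *ᴹ B ≈ᴹ A′ *ᴹ B′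
  *ᴹ-cong A≈A′ B≈B′ i j = sum-cong-≋ (λ k → *-cong (A≈A′ i k) (B≈B′ k j))

  *ᴹ-assoc : ∀ A B C → (A *ᴹ B) *ᴹ C ≈ᴹ A *ᴹ (B *ᴹ C)
  *ᴹ-assoc A B C i j = begin
    ∑[ k < n ] ((∑[ l < n ] (A i l * B l k)) * C k j)
      ≈⟨ sum-cong-≋ (λ k → *-distribʳ-sum (C k j) (λ l → A i l * B l k)) ⟩
    ∑[ k < n ] ∑[ l < n ] ((A i l * B l k) * C k j)
      ≈⟨ ∑-comm (λ k l → (A i l * B l k) * C k j) ⟩
    ∑[ l < n ] ∑[ k < n ] ((A i l * B l k) * C k j)
      ≈⟨ sum-cong-≋ (λ l → sum-cong-≋ (λ k → *-assoc (A i l) (B l k) (C k j))) ⟩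
    ∑[ l < n ] ∑[ k < n ] (A i l * (B l k * C k j))
      ≈⟨ sum-cong-≋ (λ l → *-distribˡ-sum (A i l) (λ k → B l k * C k j)) ⟨
    ∑[ l < n ] (A i l * ∑[ k < n ] (B l k * C k j))
      ∎

  *ᴹ-identityˡ : ∀ A → δ *ᴹ A ≈ᴹ A
  *ᴹ-identityˡ A i j = begin
    ∑[ k < n ] (δ i k * A k j) ≈⟨ sum-supported-at _ i (λ k k≢i →
                                    trans (*-congʳ (reflexive (δ-off (k≢i ∘ ≡.sym)))) (zeroˡ _)) ⟩
    δ i i * A i j              ≈⟨ trans (*-congʳ (reflexive (δ-diag i))) (*-identityˡ _) ⟩
    A i j                      ∎

  *ᴹ-identityʳ : ∀ A → A *ᴹ δ ≈ᴹ A
  *ᴹ-identityʳ A i j = begin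
    ∑[ k < n ] (A i k * δ k j) ≈⟨ sum-supported-at _ j (λ k k≢j →
                                    trans (*-congˡ (reflexive (δ-off k≢j))) (zeroʳ _)) ⟩
    A i j * δ j j              ≈⟨ trans (*-congˡ (reflexive (δ-diag j))) (*-identityʳ _) ⟩
    A i j                      ∎

  *ᴹ-distribˡ-+ : ∀ A B C → A *ᴹ (λ i j → B i j + C i j) ≈ᴹ λ i j → (A *ᴹ B) i j + (A *ᴹ C) i j
  *ᴹ-distribˡ-+ A B C i j = trans (sum-cong-≋ (λ k → distribˡ (A i k) (B k j) (C k j)))
                                  (∑-distrib-+ (λ k → A i k * B k j) (λ k → A i k * C k j))

  *ᴹ-distribʳ-+ : ∀ A B C → (λ i j → B i j + C i j) *ᴹ A ≈ᴹ λ i j → (B *ᴹ A) i j + (C *ᴹ A) i j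
  *ᴹ-distribʳ-+ A B C i j = trans (sum-cong-≋ (λ k → distribʳ (A k j) (B i k) (C i k)))
                                  (∑-distrib-+ (λ k → B i k * A k j) (λ k → C i k * A k j))

  matrixRing : Ring c ℓ
  matrixRing = record
    { Carrier = Mat
    ; _≈_     = _≈ᴹ_
    ; _+_     = λ A B i j → A i j + B i j
    ; _*_     = _*ᴹ_
    ; -_      = λ A i j → - A i j
    ; 0#      = λ _ _ → 0#
    ; 1#      = δ
    ; isRing  = record
      { +-isAbelianGroup = Pointwise.isAbelianGroup (Fin n)
                             (Pointwise.isAbelianGroup (Fin n) +-isAbelianGroup)
      ; *-cong           = *ᴹ-cong
      ; *-assoc          = *ᴹ-assoc
      ; *-identity       = *ᴹ-identityˡ , *ᴹ-identityʳ
      ; distrib          = *ᴹ-distribˡ-+ , *ᴹ-distribʳ-+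
      }
    }

  open import Algebra.Definitions.RawSemiring (Semiring.rawSemiring (Ring.semiring matrixRing)) public
    using () renaming (_^_ to _^ᴹ_)

  ^-vanishes-off-walks : ∀ {r} {E : Rel (Fin n) r} → Decidable E → ∀ A → (∀ u w → ¬ E u w → A u w ≈ 0#) →
    ∀ k u → (∀ p → p 0 ≡ u → ¬ IsWalk E k p) → ∀ v → (A ^ᴹ k) u v ≈ 0#
  ^-vanishes-off-walks E? A A≈0 zero    u no-walk v = ⊥-elim (no-walk (λ _ → u) ≡.refl (λ _ ()))
  ^-vanishes-off-walks {E = E} E? A A≈0 (suc k) u no-walk v = sum-zero term≈0
    where
    term≈0 : ∀ w → A u w * (A ^ᴹ k) w v ≈ 0#
    term≈0 w with E? u w
    ... | no ¬uw = trans (*-congʳ (A≈0 u w ¬uw)) (zeroˡ _)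
    ... | yes uw = trans (*-congˡ (^-vanishes-off-walks E? A A≈0 k w no-walk-from-w v)) (zeroʳ _)
      where
      no-walk-from-w : ∀ p → p 0 ≡ w → ¬ IsWalk E k p
      no-walk-from-w p p₀≡w walk = no-walk (λ { zero → u ; (suc t) → p t }) ≡.refl λ
        { zero    _       → ≡.subst (E u) (≡.sym p₀≡w) uw
        ; (suc t) (s<s t<k) → walk t t<k
        }

module Orbits {n : ℕ} where
  open import Data.Nat using (_+_)
  open import Data.Nat.Properties using (n<1+n; m≤n⇒∃[o]m+o≡n; +-comm; m≤n⇒m<n∨m≡n)
  open import Function.Endo.Propositional (Fin n) using (_^_; ^-homo)
  open ≡ using (refl; sym; trans; cong; cong-app; subst)
  open ≡.≡-Reasoning

  orbit-periodic : ∀ (s : Fin n → Fin n) z → ∃₂ λ k q → (s ^ suc q) ((s ^ k) z) ≡ (s ^ k) z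
  orbit-periodic s z with i , j , i<j , sⁱz≡sʲz ← pigeonhole (n<1+n n) (λ i → (s ^ toℕ i) z)
                     with q , i+1+q≡j ← m≤n⇒∃[o]m+o≡n i<j =
    toℕ i , q , (begin
      (s ^ suc q) ((s ^ toℕ i) z) ≡⟨ cong-app (^-homo s (suc q) (toℕ i)) z ⟨
      (s ^ (suc q + toℕ i)) z     ≡⟨ cong (λ k → (s ^ k) z) (trans (cong suc (+-comm q (toℕ i))) i+1+q≡j) ⟩
      (s ^ toℕ j) z               ≡⟨ sⁱz≡sʲz ⟨
      (s ^ toℕ i) z               ∎)

  module _ (s : Fin n → Fin n) (q : ℕ) where
    Periodic : Fin n → Set
    Periodic x = (s ^ suc q) x ≡ x

    ^-commute : ∀ k x → (s ^ k) (s x) ≡ s ((s ^ k) x)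
    ^-commute zero    x = refl
    ^-commute (suc k) x = cong s (^-commute k x)

    periodic-s : ∀ {x} → Periodic x → Periodic (s x)
    periodic-s {x} per = trans (cong s (^-commute q x)) (cong s per)

    periodic-^ : ∀ k {x} → Periodic x → Periodic ((s ^ k) x)
    periodic-^ zero    per = per
    periodic-^ (suc k) per = periodic-s (periodic-^ k per)

    private
      -- On the points of period dividing q + 1 the map s is a bijection with inverse s ^ q.
      cycle cycle⁻¹ : Fin n → Fin n
      cycle x with (s ^ suc q) x ≟ x
      ... | yes _ = s x
      ... | no  _ = x
      cycle⁻¹ x with (s ^ suc q) x ≟ x
      ... | yes _ = (s ^ q) x
      ... | no  _ = x

      cycle-periodic : ∀ {x} → Periodic x → cycle x ≡ s x
      cycle-periodic {x} per with (s ^ suc q) x ≟ x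
      ... | yes _ = refl
      ... | no ¬per = ⊥-elim (¬per per)

      cycle-aperiodic : ∀ {x} → ¬ Periodic x → cycle x ≡ x
      cycle-aperiodic {x} ¬per with (s ^ suc q) x ≟ x
      ... | yes per = ⊥-elim (¬per per)
      ... | no _ = refl

      cycle⁻¹-periodic : ∀ {x} → Periodic x → cycle⁻¹ x ≡ (s ^ q) x
      cycle⁻¹-periodic {x} per with (s ^ suc q) x ≟ x
      ... | yes _ = refl
      ... | no ¬per = ⊥-elim (¬per per)

      cycle⁻¹-aperiodic : ∀ {x} → ¬ Periodic x → cycle⁻¹ x ≡ x
      cycle⁻¹-aperiodic {x} ¬per with (s ^ suc q) x ≟ x
      ... | yes per = ⊥-elim (¬per per)
      ... | no _ = refl

      cycle-cycle⁻¹ : ∀ x → cycle (cycle⁻¹ x) ≡ x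
      cycle-cycle⁻¹ x with (s ^ suc q) x ≟ x
      ... | yes per = trans (cycle-periodic (periodic-^ q per)) per
      ... | no ¬per = cycle-aperiodic ¬per

      cycle⁻¹-cycle : ∀ x → cycle⁻¹ (cycle x) ≡ x
      cycle⁻¹-cycle x with (s ^ suc q) x ≟ x
      ... | yes per = trans (cycle⁻¹-periodic (periodic-s per)) (trans (^-commute q x) per)
      ... | no ¬per = cycle⁻¹-aperiodic ¬per

      cycle-∈ : ∀ x → cycle x ≡ x ⊎ cycle x ≡ s x
      cycle-∈ x with (s ^ suc q) x ≟ x
      ... | yes _ = inj₂ refl
      ... | no  _ = inj₁ refl

    periodic-permutation : ∃ λ (π : Permutation′ n) →
      (∀ {x} → Periodic x → π ⟨$⟩ʳ x ≡ s x) × (∀ x → π ⟨$⟩ʳ x ≡ x ⊎ π ⟨$⟩ʳ x ≡ s x)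
    periodic-permutation =
      permutation cycle cycle⁻¹ cycle-cycle⁻¹ cycle⁻¹-cycle , cycle-periodic , cycle-∈

  closed-walk-successor : ∀ {r} {R : Rel (Fin n) r} (p : ℕ → Fin n) {i j} →
    i < j → p i ≡ p j → IsWalk R j p →
    ∃ λ s → (∀ x → s x ≡ x ⊎ R x (s x)) × (∀ k → R ((s ^ k) (p i)) (s ((s ^ k) (p i))))
  closed-walk-successor {R = R} p {i} {j} i<j pᵢ≡pⱼ walk =
    s , s-moves-along-R , λ k → proj₂ (step (orbit-visited k))
    where
    Visited : Fin n → Set
    Visited x = ∃ λ (t : Fin j) → p (toℕ t) ≡ x

    visited? : ∀ x → Dec (Visited x)
    visited? x = any? (λ t → p (toℕ t) ≟ x)

    -- s follows the walk from some visit of x before time j; as p j ≡ p i, visits are closed under s.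
    s : Fin n → Fin n
    s x with visited? x
    ... | yes (t , _) = p (suc (toℕ t))
    ... | no  _       = x

    s-moves-along-R : ∀ x → s x ≡ x ⊎ R x (s x)
    s-moves-along-R x with visited? x
    ... | yes (t , pₜ≡x) = inj₂ (subst (λ y → R y (p (suc (toℕ t)))) pₜ≡x (walk (toℕ t) (toℕ<n t)))
    ... | no  _          = inj₁ refl

    visited-i : Visited (p i)
    visited-i = fromℕ< i<j , cong p (toℕ-fromℕ< i<j)

    step : ∀ {x} → Visited x → Visited (s x) × R x (s x)
    step {x} visited with visited? x
    ... | no  unvisited  = ⊥-elim (unvisited visited)
    ... | yes (t , pₜ≡x) = next , subst (λ y → R y (p (suc (toℕ t)))) pₜ≡x (walk (toℕ t) (toℕ<n t))
      where
      next : Visited (p (suc (toℕ t)))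
      next with m≤n⇒m<n∨m≡n (toℕ<n t)
      ... | inj₁ t+1<j = fromℕ< t+1<j , cong p (toℕ-fromℕ< t+1<j)
      ... | inj₂ t+1≡j = proj₁ visited-i , trans (proj₂ visited-i) (trans pᵢ≡pⱼ (cong p (sym t+1≡j)))

    orbit-visited : ∀ k → Visited ((s ^ k) (p i))
    orbit-visited zero    = visited-i
    orbit-visited (suc k) = proj₁ (step (orbit-visited k))

module Matching {n : ℕ} (X : MixedGraph n) where
  open import Data.Nat.Properties using (n<1+n; <-≤-trans)
  open import Function.Endo.Propositional (Fin n) using (_^_)
  open ≡ using (refl; sym; trans; cong; subst)
  open ≡.≡-Reasoning
  open Orbits

  Adj? : ∀ u v → Dec (Adj X u v)
  Adj? u v with link X u v
  ... | none    = no (λ ¬none → ¬none refl)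
  ... | digon   = yes (λ ())
  ... | arcTo   = yes (λ ())
  ... | arcFrom = yes (λ ())

  Adj-sym : ∀ {u v} → Adj X u v → Adj X v u
  Adj-sym {u} {v} uv vu≡none = uv (reverse-none (trans (sym (consistent X u v)) vu≡none))
    where
    reverse-none : ∀ {l} → reverse l ≡ none → l ≡ none
    reverse-none {none} _ = refl

  proper-not : ∀ {c : Fin n → Bool} → (∀ u v → Adj X u v → c u ≢ c v) →
               ∀ {u v} → Adj X u v → c v ≡ not (c u)
  proper-not proper {u} {v} uv = ¬-not (λ cv≡cu → proper u v uv (sym cv≡cu))

  module _ {m : Fin n → Fin n} (m-adj : ∀ u → Adj X u (m u)) (m-invol : ∀ u → m (m u) ≡ u) where

    AlternatingStep : Rel (Fin n) _
    AlternatingStep u w = Adj X (m u) w × w ≢ u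

    alternatingStep? : Decidable AlternatingStep
    alternatingStep? u w = Adj? (m u) w ×-dec ¬? (w ≟ u)

    m-injective : ∀ {u v} → m u ≡ m v → u ≡ v
    m-injective {u} {v} mu≡mv = trans (sym (m-invol u)) (trans (cong m mu≡mv) (m-invol v))

    adjacent-to-partner-or-self : ∀ {x y} → y ≡ x ⊎ Adj X (m x) y → Adj X (m x) y
    adjacent-to-partner-or-self (inj₁ refl) = Adj-sym (m-adj _)
    adjacent-to-partner-or-self (inj₂ adj)  = adj

    module _ (m-unique : ∀ m′ → IsPerfectMatching X m′ → ∀ u → m′ u ≡ m u) where

      private
        module Rotation (c : Fin n → Bool) (proper : ∀ u v → Adj X u v → c u ≢ c v)
                        (π : Permutation′ n) (alternating : ∀ x → Adj X (m x) (π ⟨$⟩ʳ x)) where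
          colour-π : ∀ x → c (π ⟨$⟩ʳ x) ≡ c x
          colour-π x = trans (proper-not proper (alternating x))
                             (sym (proper-not proper (Adj-sym (m-adj x))))

          colour-π⁻¹ : ∀ x → c (π ⟨$⟩ˡ x) ≡ c x
          colour-π⁻¹ x = trans (sym (colour-π (π ⟨$⟩ˡ x))) (cong c (inverseʳ π))

          rotated : Fin n → Fin n
          rotated x = if c x then m (π ⟨$⟩ˡ x) else π ⟨$⟩ʳ m x

          rotated-true : ∀ {x} → c x ≡ true → rotated x ≡ m (π ⟨$⟩ˡ x)
          rotated-true {x} = cong (λ b → if b then m (π ⟨$⟩ˡ x) else π ⟨$⟩ʳ m x)

          rotated-false : ∀ {x} → c x ≡ false → rotated x ≡ π ⟨$⟩ʳ m x
          rotated-false {x} = cong (λ b → if b then m (π ⟨$⟩ˡ x) else π ⟨$⟩ʳ m x)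

          rotated-adj : ∀ x → Adj X x (rotated x)
          rotated-adj x with c x
          ... | true  = Adj-sym (subst (Adj X (m (π ⟨$⟩ˡ x))) (inverseʳ π) (alternating (π ⟨$⟩ˡ x)))
          ... | false = subst (λ u → Adj X u (π ⟨$⟩ʳ m x)) (m-invol x) (alternating (m x))

          rotated-invol : ∀ x → rotated (rotated x) ≡ x
          rotated-invol x with c x in cx
          ... | true  = begin
            rotated (m (π ⟨$⟩ˡ x))       ≡⟨ rotated-false colour ⟩
            π ⟨$⟩ʳ m (m (π ⟨$⟩ˡ x))      ≡⟨ cong (π ⟨$⟩ʳ_) (m-invol (π ⟨$⟩ˡ x)) ⟩
            π ⟨$⟩ʳ (π ⟨$⟩ˡ x)            ≡⟨ inverseʳ π ⟩
            x                            ∎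
            where
            colour : c (m (π ⟨$⟩ˡ x)) ≡ false
            colour = trans (proper-not proper (m-adj (π ⟨$⟩ˡ x)))
                           (cong not (trans (colour-π⁻¹ x) cx))
          ... | false = begin
            rotated (π ⟨$⟩ʳ m x)         ≡⟨ rotated-true colour ⟩
            m (π ⟨$⟩ˡ (π ⟨$⟩ʳ m x))      ≡⟨ cong m (inverseˡ π) ⟩
            m (m x)                      ≡⟨ m-invol x ⟩
            x                            ∎
            where
            colour : c (π ⟨$⟩ʳ m x) ≡ true
            colour = trans (colour-π (m x)) (trans (proper-not proper (m-adj x)) (cong not cx))

          fixes-colour-class : ∀ {y} → c y ≡ true → π ⟨$⟩ʳ y ≡ y
          fixes-colour-class {y} cy = sym (m-injective my≡mπy)
            where
            my≡mπy : m y ≡ m (π ⟨$⟩ʳ y)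
            my≡mπy = begin
              m y                          ≡⟨ cong m (inverseˡ π) ⟨
              m (π ⟨$⟩ˡ (π ⟨$⟩ʳ y))        ≡⟨ rotated-true (trans (colour-π y) cy) ⟨
              rotated (π ⟨$⟩ʳ y)           ≡⟨ m-unique rotated (rotated-adj , rotated-invol) (π ⟨$⟩ʳ y) ⟩
              m (π ⟨$⟩ʳ y)                 ∎

      alternating-permutation-trivial : Bipartite X → ∀ (π : Permutation′ n) →
        (∀ x → Adj X (m x) (π ⟨$⟩ʳ x)) → ∀ y → π ⟨$⟩ʳ y ≡ y
      alternating-permutation-trivial (c , proper) π alternating y with c y in cy
      ... | true  = Rotation.fixes-colour-class c proper π alternating cy
      ... | false = Rotation.fixes-colour-class (not ∘ c) (λ u v uv → proper u v uv ∘ not-injective)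
                                                π alternating (cong not cy)

      alternating-map-fixes-orbit : Bipartite X → ∀ (s : Fin n → Fin n) → (∀ x → Adj X (m x) (s x)) →
        ∀ z → ∃ λ k → s ((s ^ k) z) ≡ (s ^ k) z
      alternating-map-fixes-orbit bipartite s alternating z
        with k , q , periodic ← orbit-periodic s z
        with π , π-periodic , π-∈ ← periodic-permutation s q =
        k , trans (sym (π-periodic periodic))
                  (alternating-permutation-trivial bipartite π π-alternating _)
        where
        π-alternating : ∀ x → Adj X (m x) (π ⟨$⟩ʳ x)
        π-alternating x = adjacent-to-partner-or-self
          (map₂ (λ πx≡sx → subst (Adj X (m x)) (sym πx≡sx) (alternating x)) (π-∈ x))

      no-long-alternating-walk : Bipartite X → ∀ p → ¬ IsWalk AlternatingStep n p
      no-long-alternating-walk bipartite p walk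
        with i , j , i<j , pᵢ≡pⱼ ← pigeonhole (n<1+n n) (p ∘ toℕ)
        with s , s-moves , orbit-steps ← closed-walk-successor {R = AlternatingStep} p i<j pᵢ≡pⱼ
                                           (λ t t<j → walk t (<-≤-trans t<j (toℕ≤pred[n] j)))
        with k , fixed ← alternating-map-fixes-orbit bipartite s
                           (λ x → adjacent-to-partner-or-self (map₂ proj₁ (s-moves x))) (p (toℕ i)) =
        proj₂ (orbit-steps k) fixed

module InvolutiveMatrices {c ℓ} (K : InvolutiveCommRing c ℓ) (n : ℕ) where
  open InvolutiveCommRing K using (Carrier; _+_; ring)
  open SquareMatrices ring n using (δ; matrixRing)
  open import Algebra.Properties.Semiring.Sum (Ring.semiring ring) using (sum)
  open RingInverses matrixRing using (Invertible)
  open ≡ using (refl; cong)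

  sumFin≡sum : ∀ {m} (f : Fin m → Carrier) → sumFin K m f ≡ sum f
  sumFin≡sum {zero}  f = refl
  sumFin≡sum {suc m} f = cong (f zero +_) (sumFin≡sum (f ∘ suc))

  identity≡δ : ∀ {m} (i j : Fin m) → identity K i j ≡ δ i j
  identity≡δ zero    zero    = refl
  identity≡δ zero    (suc j) = refl
  identity≡δ (suc i) zero    = refl
  identity≡δ (suc i) (suc j) = identity≡δ i j

  invertible⇒nonsingular : ∀ {A} → Invertible A → Nonsingular K A
  invertible⇒nonsingular {A} (B , AB≈1 , BA≈1) = B , transport A B AB≈1 , transport B A BA≈1
    where
    open InvolutiveCommRing K using (_≈_; _*_; trans; reflexive)
    transport : ∀ P Q → (∀ i j → sum (λ k → P i k * Q k j) ≈ δ i j) →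
                ∀ i j → (_·_ K P Q) i j ≈ identity K i j
    transport P Q PQ≈δ i j = trans (reflexive (sumFin≡sum (λ k → P i k * Q k j)))
                                   (trans (PQ≈δ i j) (reflexive (≡.sym (identity≡δ i j))))

module HermitianAdjacency {c ℓ} (K : InvolutiveCommRing c ℓ) {n : ℕ} (X : MixedGraph n)
  (α : InvolutiveCommRing.Carrier K)
  (αᾱ≈1 : InvolutiveCommRing._≈_ K (InvolutiveCommRing._*_ K α (InvolutiveCommRing.conj K α))
                                    (InvolutiveCommRing.1# K))
  {m : Fin n → Fin n} (m-adj : ∀ u → Adj X u (m u)) (m-invol : ∀ u → m (m u) ≡ u) where
  open InvolutiveCommRing K hiding (zero)
  open SquareMatrices ring n
  open Matching X using (AlternatingStep; alternatingStep?; no-long-alternating-walk)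
  open import Relation.Binary.Reasoning.Setoid setoid

  H : Mat
  H = hermitianAdj K α X

  entry : Link → Carrier
  entry none    = 0#
  entry digon   = 1#
  entry arcTo   = α
  entry arcFrom = conj α

  H≡entry : ∀ u v → H u v ≡ entry (link X u v)
  H≡entry u v with link X u v
  ... | none    = ≡.refl
  ... | digon   = ≡.refl
  ... | arcTo   = ≡.refl
  ... | arcFrom = ≡.refl

  entry*entry-reverse : ∀ l → l ≢ none → entry l * entry (reverse l) ≈ 1#
  entry*entry-reverse none    l≢none = ⊥-elim (l≢none ≡.refl)
  entry*entry-reverse digon   _      = *-identityˡ 1#
  entry*entry-reverse arcTo   _      = αᾱ≈1
  entry*entry-reverse arcFrom _      = trans (*-comm (conj α) α) αᾱ≈1

  entry-none : ∀ l → ¬ l ≢ none → entry l ≈ 0#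
  entry-none none    _       = refl
  entry-none digon   ¬l≢none = ⊥-elim (¬l≢none λ ())
  entry-none arcTo   ¬l≢none = ⊥-elim (¬l≢none λ ())
  entry-none arcFrom ¬l≢none = ⊥-elim (¬l≢none λ ())

  H-adjacent : ∀ {u v} → Adj X u v → H u v * H v u ≈ 1#
  H-adjacent {u} {v} uv = trans
    (reflexive (≡.cong₂ _*_ (H≡entry u v) (≡.trans (H≡entry v u) (≡.cong entry (consistent X u v)))))
    (entry*entry-reverse (link X u v) uv)

  H-nonadjacent : ∀ {u v} → ¬ Adj X u v → H u v ≈ 0#
  H-nonadjacent {u} {v} ¬uv = trans (reflexive (H≡entry u v)) (entry-none (link X u v) ¬uv)

  M : Mat
  M u v with v ≟ m u
  ... | yes _ = H u v
  ... | no  _ = 0#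

  M-matched : ∀ u → M u (m u) ≡ H u (m u)
  M-matched u with m u ≟ m u
  ... | yes _     = ≡.refl
  ... | no  ≢refl = ⊥-elim (≢refl ≡.refl)

  M≈H-off-unmatched-edges : ∀ {u v} → (Adj X u v → v ≡ m u) → M u v ≈ H u v
  M≈H-off-unmatched-edges {u} {v} matched-if-adj with v ≟ m u
  ... | yes _      = refl
  ... | no  v≢m[u] = sym (H-nonadjacent (v≢m[u] ∘ matched-if-adj))

  M-unmatched : ∀ {u v} → v ≢ m u → M u v ≈ 0#
  M-unmatched {u} {v} v≢m[u] with v ≟ m u
  ... | yes v≡m[u] = ⊥-elim (v≢m[u] v≡m[u])
  ... | no  _      = refl

  M*ᴹ : ∀ A u v → (M *ᴹ A) u v ≈ H u (m u) * A (m u) v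
  M*ᴹ A u v = trans
    (sum-supported-at _ (m u) (λ k k≢m[u] → trans (*-congʳ (M-unmatched k≢m[u])) (zeroˡ _)))
    (*-congʳ (reflexive (M-matched u)))

  M*ᴹM≈δ : M *ᴹ M ≈ᴹ δ
  M*ᴹM≈δ u v = trans (M*ᴹ M u v) (entry-at (v ≟ u))
    where
    entry-at : Dec (v ≡ u) → H u (m u) * M (m u) v ≈ δ u v
    entry-at (yes ≡.refl) = begin
      H u (m u) * M (m u) u         ≈⟨ *-congˡ (M≈H-off-unmatched-edges (λ _ → ≡.sym (m-invol u))) ⟩
      H u (m u) * H (m u) u         ≈⟨ H-adjacent (m-adj u) ⟩
      1#                            ≡⟨ ≡.sym (δ-diag u) ⟩
      δ u u                         ∎
    entry-at (no v≢u) = begin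
      H u (m u) * M (m u) v         ≈⟨ *-congˡ (M-unmatched (λ v≡mmu → v≢u (≡.trans v≡mmu (m-invol u)))) ⟩
      H u (m u) * 0#                ≈⟨ zeroʳ _ ⟩
      0#                            ≡⟨ ≡.sym (δ-off (v≢u ∘ ≡.sym)) ⟩
      δ u v                         ∎

  B : Mat
  B = M *ᴹ (λ u v → M u v - H u v)

  B-vanishes-off-alternating-steps : ∀ u w → ¬ AlternatingStep m-adj m-invol u w → B u w ≈ 0#
  B-vanishes-off-alternating-steps u w ¬step = begin
    B u w                                     ≈⟨ M*ᴹ (λ v w → M v w - H v w) u w ⟩
    H u (m u) * (M (m u) w - H (m u) w)       ≈⟨ *-congˡ (+-congʳ (M≈H-off-unmatched-edges matched-if-adj)) ⟩
    H u (m u) * (H (m u) w - H (m u) w)       ≈⟨ *-congˡ (-‿inverseʳ _) ⟩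
    H u (m u) * 0#                            ≈⟨ zeroʳ _ ⟩
    0#                                        ∎
    where
    matched-if-adj : Adj X (m u) w → w ≡ m (m u)
    matched-if-adj adj with w ≟ u
    ... | yes w≡u = ≡.trans w≡u (≡.sym (m-invol u))
    ... | no  w≢u = ⊥-elim (¬step (adj , w≢u))

  B-nilpotent : Bipartite X → (∀ m′ → IsPerfectMatching X m′ → ∀ u → m′ u ≡ m u) →
                B ^ᴹ n ≈ᴹ λ _ _ → 0#
  B-nilpotent bipartite m-unique u =
    ^-vanishes-off-walks (alternatingStep? m-adj m-invol) B B-vanishes-off-alternating-steps n u
      (λ p _ → no-long-alternating-walk m-adj m-invol m-unique bipartite p)

theorem3 : ∀ {c ℓ} (K : InvolutiveCommRing c ℓ) {n : ℕ} (X : MixedGraph n)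
             (α : InvolutiveCommRing.Carrier K) →
             InvolutiveCommRing._≈_ K (InvolutiveCommRing._*_ K α (InvolutiveCommRing.conj K α)) (InvolutiveCommRing.1# K) →
             Bipartite X → UniquePerfectMatching X →
             Nonsingular K (hermitianAdj K α X)
theorem3 K {n} X α αᾱ≈1 bipartite (m , (m-adj , m-invol) , m-unique) =
  invertible⇒nonsingular (near-involution-invertible n M*ᴹM≈δ (B-nilpotent bipartite m-unique))
  where
  open InvolutiveMatrices K n using (invertible⇒nonsingular)
  open RingInverses (SquareMatrices.matrixRing (InvolutiveCommRing.ring K) n)
    using (near-involution-invertible)
  open HermitianAdjacency K X α αᾱ≈1 m-adj m-invol using (M*ᴹM≈δ; B-nilpotent)
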